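{- Let $q\ge2$ and $n\ge1$ be integers. Under scenario $(\circ *)$, the family $\mathcal{G}_q=\{x\mapsto[\![x\ge t]\!]\}_{t\in[q\rangle}$ is $n$-cell implementable if and only if $q\le n+1$.
   Context: $[b\rangle=\{0,1,\ldots,b-1\}$. Let $\mathbb{B}=\{0,1\}$, $\mathbb{B}_\circ=\mathbb{B}$, $\mathbb{B}_*=\mathbb{B}\cup\{*\}$, $\mathbb{B}_\bullet=\mathbb{B}\cup\{*,\bullet\}$. Define $\mathrm{T}:\mathbb{B}_\bullet^2\to\mathbb{B}$ by $\mathrm{T}(u,\vartheta)=1$ if and only if $u=*$, or $\vartheta=*$, or $u=\vartheta\in\mathbb{B}$. $[\![\cdot]\!]$ is the Iverson bracket. $\mathcal{F}_q$ is the set of all functions $[q\rangle\to\mathbb{B}$. For $\alpha,\beta\in\{\circ,*,\bullet\}$, a subset $\Phi\subseteq\mathcal{F}_q$ is $n$-cell implementable under scenario $(\alpha\beta)$ if there exist mappings $\mathbf{u}=(u_j)_{j\in[n\rangle}:[q\rangle\to\mathbb{B}_\alpha^n$ and $\boldsymbol{\vartheta}=(\vartheta_j)_{j\in[n\rangle}:\Phi\to\mathbb{B}_\beta^n$ such that $f(x)=\bigwedge_{j\in[n\rangle}\mathrm{T}(u_j(x),\vartheta_j(f))$ for all $f\in\Phi$ and $x\in[q\rangle$. -}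

module Defs where

open import Data.Bool using (Bool; true; false; _∧_)
open import Data.Maybe using (Maybe; just; nothing)
open import Data.Nat using (ℕ; _≤ᵇ_)
open import Data.Fin using (Fin; toℕ)
open import Relation.Binary.PropositionalEquality using (_≡_)

data B• : Set where
  bit    : Bool → B•
  star   : B•
  bullet : B•

-- 𝔹_∘ = 𝔹 (Bool) and 𝔹_* = 𝔹 ∪ {*} (Maybe Bool, nothing = *) embedded into 𝔹_•
emb∘ : Bool → B•
emb∘ b = bit b

emb* : Maybe Bool → B•
emb* (just b) = bit b
emb* nothing  = star

beq : Bool → Bool → Bool
beq true  true  = true
beq false false = true
beq _     _     = false

T : B• → B• → Bool
T star     _        = true
T _        star     = true
T (bit a)  (bit b)  = beq a b
T _        _        = false

⋀ : (n : ℕ) → (Fin n → Bool) → Bool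
⋀ ℕ.zero    g = true
⋀ (ℕ.suc n) g = g Fin.zero ∧ ⋀ n (λ j → g (Fin.suc j))

G : (q : ℕ) → Fin q → Fin q → Bool
G q t x = toℕ t ≤ᵇ toℕ x

-- n-cell implementability of the indexed family 𝒢_q under scenario (∘ *):
-- u : [q⟩ → 𝔹_∘^n,  ϑ : 𝒢_q → 𝔹_*^n  (ϑ given on the index t; t ↦ g_t is injective)
ImplementableG∘* : (q n : ℕ) → Set
ImplementableG∘* q n =
  Σ (Fin q → Fin n → Bool) λ u →
  Σ (Fin q → Fin n → Maybe Bool) λ θ →
  (t x : Fin q) → G q t x ≡ ⋀ n (λ j → T (emb∘ (u x j)) (emb* (θ t j)))
  where open import Data.Product using (Σ)

{-# OPTIONS --safe #-}
module Submission where

-- Sufficiency: cell j fires only for the threshold t = j + 1 and then tests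
-- [x ≥ j + 1], so the conjunction over all cells is [x ≥ t]; the threshold 0
-- needs no cell, which is why n cells serve n + 1 thresholds.
--
-- Necessity: for a threshold t = i + 1 the point x = i is rejected by some
-- cell j, and that cell must accept every x ≥ i + 1. So θ_j(t) is a bit b with
-- u_j(i) ≠ b and u_j(x) = b for all x > i: the sequence u_j changes value for
-- the last time between i and i + 1. A sequence has at most one last change,
-- so i ↦ j is injective from the q − 1 nonzero thresholds into the n cells.

open import Defs
open import Data.Nat using (ℕ; _≤_; _+_)
open import Function.Bundles using (_⇔_)

open import Data.Bool using (Bool; true; false; not; _∧_; _∨_; if_then_else_)
open import Data.Bool.Properties using (T-≡; ∧-identityʳ)
open import Data.Empty using (⊥-elim)
open import Data.Fin using (Fin; zero; suc; toℕ; inject₁; fromℕ<)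
open import Data.Fin.Properties using (<-cmp; injective⇒≤; toℕ-fromℕ<; toℕ-inject₁; toℕ<n)
open import Data.Maybe using (Maybe; just; nothing)
open import Data.Nat using (_<_; _≤ᵇ_; _<ᵇ_; _≡ᵇ_; s≤s)
open import Data.Nat.Properties using (≤⇒≤ᵇ; ≤-trans; +-comm; n<1+n; m<n⇒m<1+n)
open import Data.Product using (∃; Σ-syntax; _×_; _,_; proj₁)
open import Function.Bundles using (mk⇔; Equivalence)
open import Function.Definitions using (Injective)
open import Relation.Binary using (tri<; tri≈; tri>)
open import Relation.Binary.PropositionalEquality
  using (_≡_; _≢_; refl; sym; trans; cong; subst; module ≡-Reasoning)
open import Relation.Nullary using (¬_)

⋀-cong : ∀ n {g h : Fin n → Bool} → (∀ j → g j ≡ h j) → ⋀ n g ≡ ⋀ n h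
⋀-cong ℕ.zero    g≡h = refl
⋀-cong (ℕ.suc n) g≡h
  rewrite g≡h zero | ⋀-cong n (λ j → g≡h (suc j)) = refl

⋀-true : ∀ n → ⋀ n (λ _ → true) ≡ true
⋀-true ℕ.zero    = refl
⋀-true (ℕ.suc n) = ⋀-true n

⋀-true⇒ : ∀ n (g : Fin n → Bool) → ⋀ n g ≡ true → ∀ j → g j ≡ true
⋀-true⇒ (ℕ.suc n) g ⋀g j with g zero in g₀
⋀-true⇒ (ℕ.suc n) g ⋀g zero    | true = g₀
⋀-true⇒ (ℕ.suc n) g ⋀g (suc j) | true = ⋀-true⇒ n (λ j → g (suc j)) ⋀g j

⋀-false⇒ : ∀ n (g : Fin n → Bool) → ⋀ n g ≡ false → ∃ λ j → g j ≡ false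
⋀-false⇒ (ℕ.suc n) g ⋀g with g zero in g₀
... | false = zero , g₀
... | true  with ⋀-false⇒ n (λ j → g (suc j)) ⋀g
...   | j , gj = suc j , gj

⋀-at : ∀ n (g : Fin n → Bool) k (k<n : k < n) →
       ⋀ n (λ j → not (k ≡ᵇ toℕ j) ∨ g j) ≡ g (fromℕ< k<n)
⋀-at (ℕ.suc n) g ℕ.zero    _         = trans (cong (g zero ∧_) (⋀-true n)) (∧-identityʳ (g zero))
⋀-at (ℕ.suc n) g (ℕ.suc k) (s≤s k<n) = ⋀-at n (λ j → g (suc j)) k k<n

<ᵇ-irrefl : ∀ k → (k <ᵇ k) ≡ false
<ᵇ-irrefl ℕ.zero    = refl
<ᵇ-irrefl (ℕ.suc k) = <ᵇ-irrefl k

≤⇒≤ᵇ≡true : ∀ {m n} → m ≤ n → (m ≤ᵇ n) ≡ true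
≤⇒≤ᵇ≡true m≤n = Equivalence.to T-≡ (≤⇒≤ᵇ m≤n)

star-unless : Bool → Maybe Bool
star-unless c = if c then just true else nothing

T-star-unless : ∀ a c → T (emb∘ a) (emb* (star-unless c)) ≡ not c ∨ a
T-star-unless true  true  = refl
T-star-unless false true  = refl
T-star-unless _     false = refl

thresholds-by-cells : ∀ n t x → t ≤ n →
  ⋀ n (λ j → not (t ≡ᵇ ℕ.suc (toℕ j)) ∨ (ℕ.suc (toℕ j) ≤ᵇ x)) ≡ (t ≤ᵇ x)
thresholds-by-cells n ℕ.zero    x _   = ⋀-true n
thresholds-by-cells n (ℕ.suc k) x k<n =
  trans (⋀-at n (λ j → ℕ.suc (toℕ j) ≤ᵇ x) k k<n)
        (cong (λ i → ℕ.suc i ≤ᵇ x) (toℕ-fromℕ< k<n))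

implementable : ∀ q n → q ≤ n + 1 → ImplementableG∘* q n
implementable q n q≤n+1 = u , θ , λ t x → sym (begin
    ⋀ n (λ j → T (emb∘ (u x j)) (emb* (θ t j)))
  ≡⟨ ⋀-cong n (λ j → T-star-unless (u x j) (toℕ t ≡ᵇ ℕ.suc (toℕ j))) ⟩
    ⋀ n (λ j → not (toℕ t ≡ᵇ ℕ.suc (toℕ j)) ∨ u x j)
  ≡⟨ thresholds-by-cells n (toℕ t) (toℕ x) (t≤n t) ⟩
    G q t x
  ∎)
  where
  open ≡-Reasoning
  u : Fin q → Fin n → Bool
  u x j = ℕ.suc (toℕ j) ≤ᵇ toℕ x
  θ : Fin q → Fin n → Maybe Bool
  θ t j = star-unless (toℕ t ≡ᵇ ℕ.suc (toℕ j))
  t≤n : (t : Fin q) → toℕ t ≤ n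
  t≤n t with ≤-trans (toℕ<n t) (subst (q ≤_) (+-comm n 1) q≤n+1)
  ... | s≤s t≤n = t≤n

LastChangeAt : ∀ {m} → (Fin (ℕ.suc m) → Bool) → Fin m → Set
LastChangeAt v i =
  v (inject₁ i) ≢ v (suc i) × (∀ x → toℕ i < toℕ x → v x ≡ v (suc i))

lastChange-< : ∀ {m} {v : Fin (ℕ.suc m) → Bool} {i i′ : Fin m} →
               toℕ i < toℕ i′ → LastChangeAt v i → ¬ LastChangeAt v i′
lastChange-< {i = i} {i′} i<i′ (_ , const-i) (change-i′ , _) =
  change-i′ (trans (const-i (inject₁ i′) (subst (toℕ i <_) (sym (toℕ-inject₁ i′)) i<i′))
                   (sym (const-i (suc i′) (m<n⇒m<1+n i<i′))))

lastChange-unique : ∀ {m} {v : Fin (ℕ.suc m) → Bool} {i i′ : Fin m} →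
                    LastChangeAt v i → LastChangeAt v i′ → i ≡ i′
lastChange-unique {i = i} {i′} lc lc′ with <-cmp i i′
... | tri< i<i′ _ _ = ⊥-elim (lastChange-< i<i′ lc lc′)
... | tri≈ _ i≡i′ _ = i≡i′
... | tri> _ _ i′<i = ⊥-elim (lastChange-< i′<i lc′ lc)

T-false⇒ : ∀ a m → T (emb∘ a) (emb* m) ≡ false → Σ[ b ∈ Bool ] m ≡ just b × a ≢ b
T-false⇒ true  (just false) _ = false , refl , λ ()
T-false⇒ false (just true)  _ = true  , refl , λ ()

T-true⇒ : ∀ a b → T (emb∘ a) (emb* (just b)) ≡ true → a ≡ b
T-true⇒ true  true  _ = refl
T-true⇒ false false _ = refl

module _ {m n} (u : Fin (ℕ.suc m) → Fin n → Bool) (θ : Fin (ℕ.suc m) → Fin n → Maybe Bool)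
         (implements : ∀ t x → G (ℕ.suc m) t x ≡ ⋀ n (λ j → T (emb∘ (u x j)) (emb* (θ t j))))
         where

  cell : Fin (ℕ.suc m) → Fin (ℕ.suc m) → Fin n → Bool
  cell t x j = T (emb∘ (u x j)) (emb* (θ t j))

  rejecting-cell : ∀ i → ∃ λ j → cell (suc i) (inject₁ i) j ≡ false
  rejecting-cell i =
    ⋀-false⇒ n (cell (suc i) (inject₁ i)) (trans (sym (implements (suc i) (inject₁ i))) rejects)
    where
    rejects : G (ℕ.suc m) (suc i) (inject₁ i) ≡ false
    rejects rewrite toℕ-inject₁ i = <ᵇ-irrefl (toℕ i)

  accepts : ∀ i x → toℕ i < toℕ x → ∀ j → cell (suc i) x j ≡ true
  accepts i x i<x =
    ⋀-true⇒ n (cell (suc i) x) (trans (sym (implements (suc i) x)) (≤⇒≤ᵇ≡true i<x))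

  lastChange-of-rejecting-cell : ∀ i → LastChangeAt (λ x → u x (proj₁ (rejecting-cell i))) i
  lastChange-of-rejecting-cell i with rejecting-cell i
  ... | j , rejected with T-false⇒ (u (inject₁ i) j) (θ (suc i) j) rejected
  ...   | b , θ≡b , u≢b = (λ u≡ → u≢b (trans u≡ b-after-i)) ,
                          (λ x i<x → trans (equals-b x i<x) (sym b-after-i))
    where
    equals-b : ∀ x → toℕ i < toℕ x → u x j ≡ b
    equals-b x i<x = T-true⇒ (u x j) b
      (subst (λ θij → T (emb∘ (u x j)) (emb* θij) ≡ true) θ≡b (accepts i x i<x j))

    b-after-i : u (suc i) j ≡ b
    b-after-i = equals-b (suc i) (n<1+n (toℕ i))

  rejecting-cell-injective : Injective _≡_ _≡_ (λ i → proj₁ (rejecting-cell i))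
  rejecting-cell-injective {i} {i′} j≡j′ =
    lastChange-unique (lastChange-of-rejecting-cell i)
      (subst (λ j → LastChangeAt (λ x → u x j) i′) (sym j≡j′) (lastChange-of-rejecting-cell i′))

implementable⇒ : ∀ m n → ImplementableG∘* (ℕ.suc m) n → m ≤ n
implementable⇒ m n (u , θ , implements) = injective⇒≤ (rejecting-cell-injective u θ implements)

proposition8 : (q n : ℕ) → 2 ≤ q → 1 ≤ n →
    (ImplementableG∘* q n ⇔ q ≤ n + 1)
proposition8 (ℕ.suc m) n _ _ =
  mk⇔ (λ imp → subst (ℕ.suc m ≤_) (+-comm 1 n) (s≤s (implementable⇒ m n imp)))
      (implementable (ℕ.suc m) n)
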